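{- For all integers $i,j\geq 3$ with $i\neq j$, the graph polynomials $\chi_{\mathcal{C}_i}$ and $\chi_{\mathcal{C}_j}$ are d.p.-incomparable, i.e., neither $\chi_{\mathcal{C}_i}\leq_{d.p.}\chi_{\mathcal{C}_j}$ nor $\chi_{\mathcal{C}_j}\leq_{d.p.}\chi_{\mathcal{C}_i}$. Hence there are infinitely many pairwise d.p.-incomparable graph polynomials of the form $\chi_{\mathcal{C}}$.
   Context: All graphs are finite without multiple edges. $C_i$ is the cycle on $i$ vertices and $\mathcal{C}_i$ is the class of all graphs isomorphic to $C_i$. For a graph property $\mathcal{C}$ and $k\in\mathbb{N}$, $\chi_{\mathcal{C}}(G;k)$ is the number of maps $f:V(G)\to\{1,\dots,k\}$ such that each nonempty color class $f^{ -1}(c)$ induces a graph in $\mathcal{C}$; it is known to be a polynomial in $k$, denoted $\chi_{\mathcal{C}}(G;X)$. $\mathbf{P}\leq_{d.p.}\mathbf{Q}$ means: for all graphs $G_1,G_2$, $\mathbf{Q}(G_1)=\mathbf{Q}(G_2)$ implies $\mathbf{P}(G_1)=\mathbf{P}(G_2)$. -}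

module Defs where

open import Data.Nat using (ℕ; zero; suc; _+_; _≡ᵇ_)
open import Data.Bool using (Bool; true; false; _∨_; if_then_else_)
import Data.Bool.Properties as BoolP
open import Data.Fin using (Fin; toℕ)
open import Data.Fin.Properties using (any?; all?) renaming (_≟_ to _≟F_)
open import Data.Vec using (Vec; []; _∷_; lookup)
open import Data.List using (List; map; allFin)
open import Data.Nat.ListAction using (sum)
open import Data.Product using (Σ; ∃; _×_; _,_)
open import Relation.Nullary using (Dec; yes; no; ¬_)
open import Relation.Nullary.Decidable using (map′; _×-dec_; _→-dec_; does)
open import Relation.Binary.PropositionalEquality using (_≡_)

record Graph : Set where
  field
    n   : ℕ
    E   : Fin n → Fin n → Bool
    sym : ∀ u v → E u v ≡ E v u
    irr : ∀ u → E u u ≡ false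
open Graph public

-- The cycle C_i on vertex set Fin i : a ~ b iff b = a+1 (mod i) or a = b+1 (mod i).
-- (Only used for i ≥ 3, where it is the usual cycle.)

succModℕ : (i : ℕ) → Fin i → ℕ
succModℕ i a = if suc (toℕ a) ≡ᵇ i then 0 else suc (toℕ a)

cycAdj : (i : ℕ) → Fin i → Fin i → Bool
cycAdj i a b = (succModℕ i a ≡ᵇ toℕ b) ∨ (succModℕ i b ≡ᵇ toℕ a)

-- Colourings f : V(G) → {1..k} are represented as vectors Vec (Fin k) (n G).
-- The colour class f⁻¹(c) induces a graph isomorphic to C_i iff there is an
-- isomorphism σ from C_i onto the induced subgraph G[f⁻¹(c)]:
-- σ : Fin i → V(G) injective, with image exactly f⁻¹(c), preserving and
-- reflecting adjacency.  σ is represented as a vector Vec (Fin (n G)) i.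

IsCycleIso : (i : ℕ) (G : Graph) {k : ℕ} → Vec (Fin k) (n G) → Fin k
           → Vec (Fin (n G)) i → Set
IsCycleIso i G f c σ =
    (∀ a b → lookup σ a ≡ lookup σ b → a ≡ b)
  × (∀ a → lookup f (lookup σ a) ≡ c)
  × (∀ v → lookup f v ≡ c → ∃ λ a → lookup σ a ≡ v)
  × (∀ a b → E G (lookup σ a) (lookup σ b) ≡ cycAdj i a b)

ClassInCi : (i : ℕ) (G : Graph) {k : ℕ} → Vec (Fin k) (n G) → Fin k → Set
ClassInCi i G f c = ∃ λ (σ : Vec (Fin (n G)) i) → IsCycleIso i G f c σ

GoodColouring : (i : ℕ) (G : Graph) {k : ℕ} → Vec (Fin k) (n G) → Set
GoodColouring i G {k} f = ∀ (c : Fin k) → (∃ λ v → lookup f v ≡ c) → ClassInCi i G f c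

vecAny? : ∀ {m} (l : ℕ) {P : Vec (Fin m) l → Set} → (∀ v → Dec (P v)) → Dec (∃ P)
vecAny? zero {P} P? with P? []
... | yes p = yes ([] , p)
... | no ¬p = no λ { ([] , p) → ¬p p }
vecAny? (suc l) {P} P? =
  map′ (λ { (a , v , p) → (a ∷ v) , p })
       (λ { ((a ∷ v) , p) → a , v , p })
       (any? λ a → vecAny? l {λ v → P (a ∷ v)} (λ v → P? (a ∷ v)))

isCycleIso? : (i : ℕ) (G : Graph) {k : ℕ} (f : Vec (Fin k) (n G)) (c : Fin k)
            → ∀ σ → Dec (IsCycleIso i G f c σ)
isCycleIso? i G f c σ =
      all? (λ a → all? (λ b → (lookup σ a ≟F lookup σ b) →-dec (a ≟F b)))
  ×-dec all? (λ a → lookup f (lookup σ a) ≟F c)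
  ×-dec all? (λ v → (lookup f v ≟F c) →-dec any? (λ a → lookup σ a ≟F v))
  ×-dec all? (λ a → all? (λ b → E G (lookup σ a) (lookup σ b) BoolP.≟ cycAdj i a b))

goodColouring? : (i : ℕ) (G : Graph) {k : ℕ} (f : Vec (Fin k) (n G))
               → Dec (GoodColouring i G f)
goodColouring? i G f =
  all? λ c → any? (λ v → lookup f v ≟F c)
             →-dec vecAny? i (isCycleIso? i G f c)

countVec : (k l : ℕ) {P : Vec (Fin k) l → Set} → (∀ v → Dec (P v)) → ℕ
countVec k zero    P? = if does (P? []) then 1 else 0
countVec k (suc l) P? = sum (map (λ c → countVec k l (λ v → P? (c ∷ v))) (allFin k))

χC : (i : ℕ) → Graph → ℕ → ℕ
χC i G k = countVec k (n G) (goodColouring? i G)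

-- Equality of graph polynomials: the polynomials χ(G₁;X), χ(G₂;X) are equal
-- iff they agree at every k ∈ ℕ (infinitely many points).
GraphPoly : Set
GraphPoly = Graph → ℕ → ℕ

SamePoly : GraphPoly → Graph → Graph → Set
SamePoly P G₁ G₂ = ∀ k → P G₁ k ≡ P G₂ k

_≤dp_ : GraphPoly → GraphPoly → Set
P ≤dp Q = ∀ G₁ G₂ → SamePoly Q G₁ G₂ → SamePoly P G₁ G₂

module Submission where

-- The two graphs C_i (the cycle) and K₁ (a single vertex) are
-- not distinguished by χ_{𝒞_j} when j ≠ i: neither admits any 𝒞_j-colouring,
-- so χ_{𝒞_j}(C_i; k) = 0 = χ_{𝒞_j}(K₁; k) for every k.  They are distinguished
-- by χ_{𝒞_i}, since the constant colouring of C_i with one colour is a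
-- 𝒞_i-colouring, while K₁ has none: χ_{𝒞_i}(C_i; 1) ≥ 1 > 0 = χ_{𝒞_i}(K₁; 1).
-- By symmetry this refutes both χ_{𝒞_i} ≤_{d.p.} χ_{𝒞_j} and the converse.

open import Defs hiding (sym)
open import Data.Nat using (ℕ; zero; suc; _≤_; _<_; _≡ᵇ_; s≤s; z≤n)
open import Data.Nat.Properties
  using (≡ᵇ⇒≡; ≡⇒≡ᵇ; ≤∧≢⇒<; <⇒≤; ≤-antisym; ≤-trans; <-irrefl; suc-injective;
         0≢1+n; 1+n≢n; n<1+n; m<n⇒m<1+n; m≤m+n; m≤n+m)
open import Data.Bool using (true; false; T; if_then_else_)
open import Data.Bool.Properties using (T-≡; T-∨; ∨-comm; ¬-not)
open import Data.Fin using (Fin; toℕ; fromℕ; fromℕ<; inject₁)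
open import Data.Fin.Properties
  using (toℕ-injective; toℕ<n; toℕ-fromℕ; toℕ-fromℕ<; toℕ-inject₁; injective⇒≤)
open import Data.Fin.Induction using (<-weakInduction)
open import Data.Vec using (Vec; []; _∷_; lookup; replicate; allFin)
open import Data.Vec.Properties using (lookup-replicate; lookup-allFin)
open import Data.List using (List; map)
  renaming ([] to []ₗ; _∷_ to _∷ₗ_; allFin to allFinₗ)
open import Data.List.Relation.Unary.Any using (here; there)
open import Data.List.Membership.Propositional using (_∈_)
open import Data.List.Membership.Propositional.Properties using (∈-allFin)
open import Data.Nat.ListAction using (sum)
open import Data.Product using (∃; _×_; _,_; proj₁; proj₂)
open import Data.Sum using (_⊎_; inj₁; inj₂; [_,_])
open import Data.Empty using (⊥)
import Data.Sum as Sum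
open import Function using (_∘_)
open import Function.Bundles using (Equivalence)
open import Relation.Nullary using (¬_; Dec; yes; no; contradiction)
open import Relation.Binary.PropositionalEquality
  using (_≡_; _≢_; refl; sym; trans; cong; cong₂; subst; module ≡-Reasoning)

data SuccView (i : ℕ) (a : Fin i) : Set where
  wrap : suc (toℕ a) ≡ i → succModℕ i a ≡ 0 → SuccView i a
  step : suc (toℕ a) < i → succModℕ i a ≡ suc (toℕ a) → SuccView i a

succView : ∀ {i} (a : Fin i) → SuccView i a
succView {i} a with suc (toℕ a) ≡ᵇ i in eq
... | true  = wrap (≡ᵇ⇒≡ _ _ (Equivalence.from T-≡ eq)) (cong (if_then 0 else suc (toℕ a)) eq)
... | false = step (≤∧≢⇒< (toℕ<n a) (λ e → subst T eq (≡⇒≡ᵇ _ _ e)))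
                   (cong (if_then 0 else suc (toℕ a)) eq)

succModℕ<i : ∀ {i} (a : Fin i) → succModℕ i a < i
succModℕ<i {i} a with succView a
... | wrap e s = subst (_< i) (sym s) (subst (0 <_) e (s≤s z≤n))
... | step lt s = subst (_< i) (sym s) lt

next : ∀ {i} → Fin i → Fin i
next a = fromℕ< (succModℕ<i a)

toℕ-next : ∀ {i} (a : Fin i) → toℕ (next a) ≡ succModℕ i a
toℕ-next a = toℕ-fromℕ< (succModℕ<i a)

succModℕ-next : ∀ {i} {a b : Fin i} → next a ≡ b → succModℕ i a ≡ toℕ b
succModℕ-next {a = a} refl = sym (toℕ-next a)

succModℕ-injective : ∀ {i} {a b : Fin i} → succModℕ i a ≡ succModℕ i b → a ≡ b
succModℕ-injective {a = a} {b} e with succView a | succView b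
... | wrap ea _ | wrap eb _ = toℕ-injective (suc-injective (trans ea (sym eb)))
... | wrap _ sa | step _ sb = contradiction (trans (sym sa) (trans e sb)) 0≢1+n
... | step _ sa | wrap _ sb = contradiction (trans (sym sb) (trans (sym e) sa)) 0≢1+n
... | step _ sa | step _ sb = toℕ-injective (suc-injective (trans (sym sa) (trans e sb)))

next-injective : ∀ {i} (a b : Fin i) → next a ≡ next b → a ≡ b
next-injective a b e = succModℕ-injective (trans (succModℕ-next e) (toℕ-next b))

prev : ∀ {N} → Fin (suc N) → Fin (suc N)
prev {N} Fin.zero = fromℕ N
prev (Fin.suc a)  = inject₁ a

next-inject₁ : ∀ {N} (a : Fin N) → next (inject₁ a) ≡ Fin.suc a
next-inject₁ {N} a with succView (inject₁ a)
... | wrap e _ = contradiction (trans (sym (toℕ-inject₁ a)) (suc-injective e))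
                               (λ ta≡N → <-irrefl ta≡N (toℕ<n a))
... | step _ s = toℕ-injective (trans (toℕ-next _) (trans s (cong suc (toℕ-inject₁ a))))

next-prev : ∀ {N} (a : Fin (suc N)) → next (prev a) ≡ a
next-prev {N} Fin.zero with succView (fromℕ N)
... | wrap _ s  = toℕ-injective (trans (toℕ-next _) s)
... | step lt _ = contradiction (subst (λ m → suc m < suc N) (toℕ-fromℕ N) lt) (<-irrefl refl)
next-prev (Fin.suc a) = next-inject₁ a

next-induction : ∀ {N ℓ} (P : Fin (suc N) → Set ℓ)
  → P Fin.zero → (∀ x → P x → P (next x)) → ∀ x → P x
next-induction P P0 closed =
  <-weakInduction P P0 (λ a Pa → subst P (next-inject₁ a) (closed (inject₁ a) Pa))

next-irreflexive : ∀ {i} → 2 ≤ i → (a : Fin i) → next a ≢ a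
next-irreflexive {i} hi a e with succView a
... | wrap ea sa = contradiction (subst (2 ≤_) i≡1 hi) λ { (s≤s ()) }
  where
  i≡1 : i ≡ 1
  i≡1 = trans (sym ea) (cong suc (trans (sym (succModℕ-next e)) sa))
... | step _ sa  = 1+n≢n (trans (sym sa) (succModℕ-next e))

next²-irreflexive : ∀ {i} → 3 ≤ i → (a : Fin i) → next (next a) ≢ a
next²-irreflexive {i} hi a e = cases (succView a) (succView (next a)) (succModℕ-next e)
  where
  open ≡-Reasoning
  ≢2 : i ≢ 2
  ≢2 i≡2 = contradiction (subst (3 ≤_) i≡2 hi) λ { (s≤s (s≤s ())) }
  ≢1 : i ≢ 1
  ≢1 i≡1 = contradiction (subst (3 ≤_) i≡1 hi) λ { (s≤s ()) }
  cases : SuccView i a → SuccView i (next a) → succModℕ i (next a) ≡ toℕ a → ⊥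
  cases (step _ sa) (step _ sb) back = <-irrefl (begin
    toℕ a                        ≡⟨ sym back ⟩
    succModℕ i (next a)          ≡⟨ sb ⟩
    suc (toℕ (next a))           ≡⟨ cong suc (trans (toℕ-next a) sa) ⟩
    suc (suc (toℕ a))            ∎) (m<n⇒m<1+n (n<1+n _))
  cases (step _ sa) (wrap eb sb) back = ≢2 (begin
    i                            ≡⟨ sym eb ⟩
    suc (toℕ (next a))           ≡⟨ cong suc (trans (toℕ-next a) sa) ⟩
    suc (suc (toℕ a))            ≡⟨ cong (suc ∘ suc) (trans (sym back) sb) ⟩
    2                            ∎)
  cases (wrap ea sa) (step _ sb) back = ≢2 (begin
    i                            ≡⟨ sym ea ⟩
    suc (toℕ a)                  ≡⟨ cong suc (sym back) ⟩
    suc (succModℕ i (next a))    ≡⟨ cong suc sb ⟩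
    suc (suc (toℕ (next a)))     ≡⟨ cong (suc ∘ suc) (trans (toℕ-next a) sa) ⟩
    2                            ∎)
  cases (wrap _ sa) (wrap eb _) _ = ≢1 (trans (sym eb) (cong suc (trans (toℕ-next a) sa)))

Adjacent : ∀ {i} → Fin i → Fin i → Set
Adjacent a b = next a ≡ b ⊎ next b ≡ a

cycAdj⇒Adjacent : ∀ {i} {a b : Fin i} → cycAdj i a b ≡ true → Adjacent a b
cycAdj⇒Adjacent {i} h = Sum.map fromT fromT (Equivalence.to T-∨ (Equivalence.from T-≡ h))
  where
  fromT : ∀ {x y} → T (succModℕ i x ≡ᵇ toℕ y) → next x ≡ y
  fromT t = toℕ-injective (trans (toℕ-next _) (≡ᵇ⇒≡ _ _ t))

Adjacent⇒cycAdj : ∀ {i} {a b : Fin i} → Adjacent a b → cycAdj i a b ≡ true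
Adjacent⇒cycAdj {i} ab = Equivalence.to T-≡ (Equivalence.from T-∨ (Sum.map toT toT ab))
  where
  toT : ∀ {x y : Fin i} → next x ≡ y → T (succModℕ i x ≡ᵇ toℕ y)
  toT e = ≡⇒≡ᵇ _ _ (succModℕ-next e)

-- A vertex of C_i has only its successor and its predecessor as neighbours,
-- so of two distinct neighbours one must be the successor.
distinct-neighbours : ∀ {i} {x y z : Fin i}
  → cycAdj i x y ≡ true → cycAdj i x z ≡ true → y ≢ z → next x ≡ y ⊎ next x ≡ z
distinct-neighbours xy xz y≢z with cycAdj⇒Adjacent xy | cycAdj⇒Adjacent xz
... | inj₁ e  | _       = inj₁ e
... | inj₂ _  | inj₁ e  = inj₂ e
... | inj₂ ey | inj₂ ez = contradiction (next-injective _ _ (trans ey (sym ez))) y≢z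

cycAdj-irreflexive : ∀ {i} → 2 ≤ i → (a : Fin i) → cycAdj i a a ≡ false
cycAdj-irreflexive {i} hi a =
  ¬-not λ loop → next-irreflexive hi a (Sum.reduce (cycAdj⇒Adjacent {i} {a} {a} loop))

Cycle : (i : ℕ) → 2 ≤ i → Graph
Cycle i hi = record
  { n   = i
  ; E   = cycAdj i
  ; sym = λ a b → ∨-comm (succModℕ i a ≡ᵇ toℕ b) (succModℕ i b ≡ᵇ toℕ a)
  ; irr = cycAdj-irreflexive hi
  }

K₁ : Graph
K₁ = record { n = 1 ; E = λ _ _ → false ; sym = λ _ _ → refl ; irr = λ _ → refl }

-- A colour class inducing C_j has at least j vertices, since
-- the isomorphism from C_j is injective.  In particular K₁ has no 𝒞_j-colouring.
cycleClass-size : ∀ {j} (G : Graph) {k} {f : Vec (Fin k) (n G)} {c : Fin k}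
  → ClassInCi j G f c → j ≤ n G
cycleClass-size G (_ , inj , _) = injective⇒≤ (λ {a} {b} → inj a b)

K₁-noColouring : ∀ {j k} → 2 ≤ j → (f : Vec (Fin k) 1) → ¬ GoodColouring j K₁ f
K₁-noColouring {j} hj f good = contradiction (≤-trans hj (cycleClass-size K₁ {f = f} class))
                                          λ { (s≤s ()) }
  where
  class : ClassInCi j K₁ f (lookup f Fin.zero)
  class = good (lookup f Fin.zero) (Fin.zero , refl)

-- If a colour class of C_i induces C_j with j ≥ 3, then it is closed under
-- `next`: a class vertex x = σ a has the two distinct neighbours σ (next a)
-- and σ (prev a) in the class, and one of them is next x.
cycleClass-next-closed : ∀ {i j k} (hi : 2 ≤ i) → 3 ≤ j
  → {f : Vec (Fin k) i} {c : Fin k} {σ : Vec (Fin i) j}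
  → IsCycleIso j (Cycle i hi) f c σ → ∀ x → lookup f x ≡ c → lookup f (next x) ≡ c
cycleClass-next-closed {i} {suc j} hi hj {f} {c} {σ} (inj , img , cov , adj) x fx≡c
  with cov x fx≡c
... | a , refl = [ inClass , inClass ] (distinct-neighbours
        (edge (next a) (inj₁ refl)) (edge (prev a) (inj₂ (next-prev a))) distinct)
  where
  edge : ∀ b → Adjacent a b → cycAdj i (lookup σ a) (lookup σ b) ≡ true
  edge b ab = trans (adj a b) (Adjacent⇒cycAdj ab)
  -- next a = prev a would make a its own second successor.
  distinct : lookup σ (next a) ≢ lookup σ (prev a)
  distinct e = next²-irreflexive hj a (trans (cong next (inj _ _ e)) (next-prev a))
  inClass : ∀ {b} → next (lookup σ a) ≡ lookup σ b → lookup f (next (lookup σ a)) ≡ c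
  inClass {b} e = subst (λ y → lookup f y ≡ c) (sym e) (img b)

-- A surjection Fin m → Fin n forces n ≤ m, as its section is injective.
surjective⇒≤ : ∀ {m n} {g : Fin m → Fin n} → (∀ y → ∃ λ x → g x ≡ y) → n ≤ m
surjective⇒≤ {g = g} onto = injective⇒≤ {f = proj₁ ∘ onto} λ {y} {y′} e →
  trans (sym (proj₂ (onto y))) (trans (cong g e) (proj₂ (onto y′)))

-- Hence a 𝒞_j-colouring (j ≥ 3) of C_i has a single class, all of C_i, and
-- the isomorphism C_j ≅ C_i is a bijection Fin j → Fin i: so i = j.
cycle-colouring-length : ∀ {i j k} (hi : 2 ≤ i) → 3 ≤ j
  → (f : Vec (Fin k) i) → GoodColouring j (Cycle i hi) f → i ≡ j
cycle-colouring-length {zero} () hj f good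
cycle-colouring-length {suc _} hi hj f good with good (lookup f Fin.zero) (Fin.zero , refl)
... | σ , iso@(inj , _ , cov , _) =
  ≤-antisym (surjective⇒≤ onto) (injective⇒≤ λ {a} {b} → inj a b)
  where
  everywhere : ∀ x → lookup f x ≡ lookup f Fin.zero
  everywhere = next-induction _ refl (cycleClass-next-closed hi hj {f} {σ = σ} iso)
  onto : ∀ x → ∃ λ a → lookup σ a ≡ x
  onto x = cov x (everywhere x)

-- With one colour, colouring all of C_i alike is a 𝒞_i-colouring: its only
-- class is the whole cycle, induced by the identity.
Cycle-monochromatic : ∀ {i} (hi : 2 ≤ i)
  → GoodColouring i (Cycle i hi) {1} (replicate i Fin.zero)
Cycle-monochromatic {i} hi Fin.zero _ = allFin i , inj , img , cov , adj
  where
  img : ∀ a → lookup (replicate i Fin.zero) (lookup (allFin i) a) ≡ Fin.zero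
  img a = lookup-replicate (lookup (allFin i) a) Fin.zero
  cov : ∀ x → lookup (replicate i Fin.zero) x ≡ Fin.zero → ∃ λ a → lookup (allFin i) a ≡ x
  cov x _ = x , lookup-allFin x
  inj : ∀ a b → lookup (allFin i) a ≡ lookup (allFin i) b → a ≡ b
  inj a b e = trans (sym (lookup-allFin a)) (trans e (lookup-allFin b))
  adj : ∀ a b → cycAdj i (lookup (allFin i) a) (lookup (allFin i) b) ≡ cycAdj i a b
  adj a b = cong₂ (cycAdj i) (lookup-allFin a) (lookup-allFin b)

sum-map-zero : ∀ {A : Set} (g : A → ℕ) (xs : List A) → (∀ x → g x ≡ 0) → sum (map g xs) ≡ 0
sum-map-zero g []ₗ       g≡0 = refl
sum-map-zero g (x ∷ₗ xs) g≡0 rewrite g≡0 x = sum-map-zero g xs g≡0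

∈⇒≤sum-map : ∀ {A : Set} (g : A → ℕ) {x : A} {xs : List A} → x ∈ xs → g x ≤ sum (map g xs)
∈⇒≤sum-map g {xs = y ∷ₗ ys} (here refl) = m≤m+n (g y) _
∈⇒≤sum-map g {xs = y ∷ₗ ys} (there x∈ys) = ≤-trans (∈⇒≤sum-map g x∈ys) (m≤n+m _ (g y))

countVec-empty : ∀ k l {P : Vec (Fin k) l → Set} (P? : ∀ v → Dec (P v))
  → (∀ v → ¬ P v) → countVec k l P? ≡ 0
countVec-empty k zero    P? ¬P with P? []
... | yes p = contradiction p (¬P [])
... | no _  = refl
countVec-empty k (suc l) P? ¬P =
  sum-map-zero _ (allFinₗ k) λ c → countVec-empty k l (P? ∘ (c ∷_)) (¬P ∘ (c ∷_))

countVec-inhabited : ∀ k l {P : Vec (Fin k) l → Set} (P? : ∀ v → Dec (P v))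
  → ∀ v → P v → 1 ≤ countVec k l P?
countVec-inhabited k zero    P? [] p with P? []
... | yes _ = s≤s z≤n
... | no ¬p = contradiction p ¬p
countVec-inhabited k (suc l) P? (c ∷ v) p =
  ≤-trans (countVec-inhabited k l (P? ∘ (c ∷_)) v p)
          (∈⇒≤sum-map (λ c′ → countVec k l (P? ∘ (c′ ∷_))) (∈-allFin c))

χC-zero : ∀ {i} (G : Graph) → (∀ {k} (f : Vec (Fin k) (n G)) → ¬ GoodColouring i G f)
  → ∀ k → χC i G k ≡ 0
χC-zero {i} G none k = countVec-empty k (n G) (goodColouring? i G) none

χC-positive : ∀ {i} (G : Graph) {k} (f : Vec (Fin k) (n G)) → GoodColouring i G f
  → 1 ≤ χC i G k
χC-positive {i} G {k} f good = countVec-inhabited k (n G) (goodColouring? i G) f good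

-- For i ≠ j (both ≥ 3) the pair C_i, K₁ witnesses ¬ (χ_{𝒞_i} ≤_{d.p.} χ_{𝒞_j}).
not-dp-below : ∀ {i j} → 3 ≤ i → 3 ≤ j → i ≢ j → ¬ (χC i ≤dp χC j)
not-dp-below {i} {j} hi hj i≢j dp = <-irrefl (sym χi-K₁) χi-K₁-positive
  where
  Cᵢ : Graph
  Cᵢ = Cycle i (<⇒≤ hi)
  χj-agrees : SamePoly (χC j) Cᵢ K₁
  χj-agrees k = trans (χC-zero Cᵢ (λ f → i≢j ∘ cycle-colouring-length (<⇒≤ hi) hj f) k)
                      (sym (χC-zero K₁ (K₁-noColouring (<⇒≤ hj)) k))
  χi-Cᵢ : 1 ≤ χC i Cᵢ 1
  χi-Cᵢ = χC-positive Cᵢ (replicate i Fin.zero) (Cycle-monochromatic (<⇒≤ hi))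
  χi-K₁ : χC i K₁ 1 ≡ 0
  χi-K₁ = χC-zero K₁ (K₁-noColouring (<⇒≤ hi)) 1
  χi-K₁-positive : 1 ≤ χC i K₁ 1
  χi-K₁-positive = subst (1 ≤_) (dp Cᵢ K₁ χj-agrees 1) χi-Cᵢ

theorem14 : ∀ (i j : ℕ) → 3 ≤ i → 3 ≤ j → i ≢ j
          → ¬ (χC i ≤dp χC j) × ¬ (χC j ≤dp χC i)
theorem14 i j hi hj i≢j = not-dp-below hi hj i≢j , not-dp-below hj hi (i≢j ∘ sym)
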